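{- Let $m,n$ be integers with $1\le m<n$ and $n\le 2m+1$. Then the metric dimension of the Villarceau grid Type II satisfies $\dim(VG^2_{m,n})\le 3$.
   Context: For a connected graph $G$ and an ordered set $R=\{r_1,\dots,r_l\}\subseteq V(G)$, the code of a vertex $s$ is $(d(s,r_1),\dots,d(s,r_l))$, where $d$ is the shortest-path distance. $R$ is a resolving set if distinct vertices have distinct codes; $\dim(G)$ is the minimum cardinality of a resolving set. For integers $1\le m<n$, the Villarceau grid Type II $VG^2_{m,n}$ is the graph with vertex set $\{(2i+1,2j+1): i\in\{0,\dots,n-2\},\ j\in\{0,\dots,m-1\}\}\cup\{(2i,2j): i\in\{0,\dots,n-1\},\ j\in\{0,\dots,m\}\}$, in which $(i_1,j_1)$ and $(i_2,j_2)$ are adjacent if and only if $|i_1-i_2|=1$ and $|j_1-j_2|=1$. -}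

module Defs where

open import Data.Nat using (ℕ; zero; suc; _+_; _*_; _∸_; _≤_; _<_; ∣_-_∣)
open import Data.Product using (_×_; _,_; ∃-syntax)
open import Data.Sum using (_⊎_)
open import Data.List using (List; length)
open import Data.List.Relation.Unary.All using (All)
open import Data.List.Membership.Propositional using (_∈_)
open import Relation.Binary.PropositionalEquality using (_≡_; _≢_)
open import Relation.Nullary using (¬_)

Point : Set
Point = ℕ × ℕ

IsVertex : ℕ → ℕ → Point → Set
IsVertex m n (x , y) =
  (∃[ i ] ∃[ j ] (x ≡ 2 * i + 1 × y ≡ 2 * j + 1 × i + 2 ≤ n × j + 1 ≤ m))
  ⊎ (∃[ i ] ∃[ j ] (x ≡ 2 * i × y ≡ 2 * j × i + 1 ≤ n × j ≤ m))

Adj : Point → Point → Set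
Adj (x₁ , y₁) (x₂ , y₂) = ∣ x₁ - x₂ ∣ ≡ 1 × ∣ y₁ - y₂ ∣ ≡ 1

data Walk (m n : ℕ) : Point → Point → ℕ → Set where
  here : ∀ {u} → IsVertex m n u → Walk m n u u 0
  step : ∀ {u w v k} → IsVertex m n u → Adj u w → Walk m n w v k →
         Walk m n u v (suc k)

Dist : ℕ → ℕ → Point → Point → ℕ → Set
Dist m n u v k = Walk m n u v k × (∀ k′ → k′ < k → ¬ Walk m n u v k′)

IsResolving : ℕ → ℕ → List Point → Set
IsResolving m n R =
  All (IsVertex m n) R ×
  (∀ s t → IsVertex m n s → IsVertex m n t → s ≢ t →
    ∃[ r ] ∃[ a ] ∃[ b ] (r ∈ R × Dist m n s r a × Dist m n t r b × a ≢ b))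

DimLE : ℕ → ℕ → ℕ → Set
DimLE m n k = ∃[ R ] (IsResolving m n R × length R ≤ k)

{-# OPTIONS --safe #-}
-- With W = 2(n-1) and H = 2m, the vertices of VG²_{m,n} are the points (x , y) of [0,W] × [0,H]
-- with x ≡ y (mod 2) and every edge is a diagonal unit move, so the graph distance is the
-- Chebyshev distance ∣x-x′∣ ⊔ ∣y-y′∣: a coordinate that is already close enough wastes the
-- surplus moves in back-and-forth pairs, which parity allows.  Seen from the landmarks (0,0),
-- (H,H) and (W,0), the diagonals through (0,0) and (W,0) cut the box into three wedges; the
-- wedge of a vertex can be read off its three distances, and inside each wedge two of the
-- distances are explicit functions of x and y.  Below both diagonals y is recovered from the
-- distance to (H,H) only because ∣x-H∣ ≤ H ∸ y there, and this is where n ≤ 2m+1 is needed.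
module Submission where

open import Defs
open import Data.Nat using (ℕ; zero; suc; _+_; _*_; _∸_; _≤_; _<_; _≮_; ∣_-_∣; _⊔_; z≤n; s≤s; s≤s⁻¹; parity; _≟_; _<?_; _≤?_)
open import Data.Nat.Properties
open import Data.Parity.Base as ℙ using (0ℙ; 1ℙ; _⁻¹)
open import Data.Parity.Properties using (suc-homo-⁻¹; ⁻¹-selfInverse; +-homo-+; *-homo-*)
open import Data.Product using (_×_; _,_; ∃-syntax; proj₁; proj₂)
open import Data.Sum using (inj₁; inj₂)
open import Data.List using (List; _∷_; [])
open import Data.List.Relation.Unary.All using (_∷_; [])
open import Data.List.Relation.Unary.Any using (here; there)
open import Data.List.Membership.Propositional using (_∈_)
open import Relation.Binary.PropositionalEquality
open import Relation.Nullary using (yes; no; contradiction)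
open import Function using (_∘_)

parity-suc : ∀ n → parity (suc n) ≡ parity n ⁻¹
parity-suc n = sym (⁻¹-selfInverse (suc-homo-⁻¹ n))

parity-double : ∀ i → parity (2 * i) ≡ 0ℙ
parity-double i = *-homo-* 2 i

parity-double+1 : ∀ i → parity (2 * i + 1) ≡ 1ℙ
parity-double+1 i = trans (+-homo-+ (2 * i) 1) (cong (ℙ._+ 1ℙ) (parity-double i))

parity-∣-∣ : ∀ m n → parity ∣ m - n ∣ ≡ parity (m + n)
parity-∣-∣ zero    n       = refl
parity-∣-∣ (suc m) zero    = cong parity (sym (+-identityʳ (suc m)))
parity-∣-∣ (suc m) (suc n) = trans (parity-∣-∣ m n) (cong (λ k → parity (suc k)) (sym (+-suc m n)))

∣m-n∣≡1⇒parity-flip : ∀ m n → ∣ m - n ∣ ≡ 1 → parity n ≡ parity m ⁻¹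
∣m-n∣≡1⇒parity-flip zero          (suc zero) _ = refl
∣m-n∣≡1⇒parity-flip (suc zero)    zero       _ = refl
∣m-n∣≡1⇒parity-flip (suc m)       (suc n)    e = begin
  parity (suc n)   ≡⟨ parity-suc n ⟩
  parity n ⁻¹      ≡⟨ cong _⁻¹ (∣m-n∣≡1⇒parity-flip m n e) ⟩
  parity m ⁻¹ ⁻¹   ≡⟨ cong _⁻¹ (parity-suc m) ⟨
  parity (suc m) ⁻¹ ∎
  where open ≡-Reasoning

data Halving : ℕ → Set where
  even : ∀ i → Halving (2 * i)
  odd  : ∀ i → Halving (2 * i + 1)

halving : ∀ x → Halving x
halving zero          = even 0
halving (suc zero)    = odd 0
halving (suc (suc x)) with halving x
... | even i = subst Halving (*-suc 2 i) (even (suc i))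
... | odd i  = subst Halving (cong (_+ 1) (*-suc 2 i)) (odd (suc i))

m<n⇒2m+1≤2n : ∀ {m n} → m < n → 2 * m + 1 ≤ 2 * n
m<n⇒2m+1≤2n {m} {n} m<n = subst (_≤ 2 * n) (+-comm 1 (2 * m)) (*-monoʳ-< 2 m<n)

2m+1≤2n⇒m<n : ∀ {m n} → 2 * m + 1 ≤ 2 * n → m < n
2m+1≤2n⇒m<n {m} {n} le = *-cancelˡ-< 2 m n (subst (_≤ 2 * n) (+-comm (2 * m) 1) le)

Checkerboard : ℕ → ℕ → Point → Set
Checkerboard W H (x , y) = x ≤ W × y ≤ H × parity x ≡ parity y

module _ {m n : ℕ} where

  isVertex⇒checkerboard : ∀ {p} → IsVertex m (suc n) p → Checkerboard (2 * n) (2 * m) p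
  isVertex⇒checkerboard (inj₁ (i , j , refl , refl , i+2≤1+n , j+1≤m)) =
    m<n⇒2m+1≤2n (s≤s⁻¹ (subst (_≤ suc n) (+-comm i 2) i+2≤1+n)) ,
    m<n⇒2m+1≤2n (subst (_≤ m) (+-comm j 1) j+1≤m) ,
    trans (parity-double+1 i) (sym (parity-double+1 j))
  isVertex⇒checkerboard (inj₂ (i , j , refl , refl , i+1≤1+n , j≤m)) =
    *-monoʳ-≤ 2 (s≤s⁻¹ (subst (_≤ suc n) (+-comm i 1) i+1≤1+n)) ,
    *-monoʳ-≤ 2 j≤m ,
    trans (parity-double i) (sym (parity-double j))

  checkerboard⇒isVertex : ∀ {x y} → Checkerboard (2 * n) (2 * m) (x , y) → IsVertex m (suc n) (x , y)
  checkerboard⇒isVertex {x} {y} (x≤2n , y≤2m , px≡py) with halving x | halving y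
  ... | even i | even j = inj₂ (i , j , refl , refl ,
          subst (_≤ suc n) (+-comm 1 i) (s≤s (*-cancelˡ-≤ 2 x≤2n)) , *-cancelˡ-≤ 2 y≤2m)
  ... | odd i  | odd j  = inj₁ (i , j , refl , refl ,
          subst (_≤ suc n) (+-comm 2 i) (s≤s (2m+1≤2n⇒m<n x≤2n)) ,
          subst (_≤ m) (+-comm 1 j) (2m+1≤2n⇒m<n y≤2m))
  ... | even i | odd j  with () ← trans (sym (parity-double i)) (trans px≡py (parity-double+1 j))
  ... | odd i  | even j with () ← trans (sym (parity-double j)) (trans (sym px≡py) (parity-double+1 i))

chebyshev : Point → Point → ℕ
chebyshev (x , y) (x′ , y′) = ∣ x - x′ ∣ ⊔ ∣ y - y′ ∣

∣-∣-unit-step : ∀ {x x′ z k} → ∣ x - x′ ∣ ≡ 1 → ∣ x′ - z ∣ ≤ k → ∣ x - z ∣ ≤ suc k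
∣-∣-unit-step {x} {x′} {z} {k} e le =
  ≤-trans (∣-∣-triangle x x′ z) (subst (λ d → d + ∣ x′ - z ∣ ≤ suc k) (sym e) (s≤s le))

chebyshev≤walk-length : ∀ {m n u v k} → Walk m n u v k → chebyshev u v ≤ k
chebyshev≤walk-length (here {x , y} _) = ≤-reflexive (cong₂ _⊔_ (∣n-n∣≡0 x) (∣n-n∣≡0 y))
chebyshev≤walk-length (step {x , y} {x′ , y′} {z , w} {k} _ (e₁ , e₂) walk) =
  ⊔-lub (∣-∣-unit-step {x} e₁ (m⊔n≤o⇒m≤o _ _ bound)) (∣-∣-unit-step {y} e₂ (m⊔n≤o⇒n≤o _ _ bound))
  where
    bound : ∣ x′ - z ∣ ⊔ ∣ y′ - w ∣ ≤ k
    bound = chebyshev≤walk-length walk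

∣1+n-n∣≡1 : ∀ n → ∣ suc n - n ∣ ≡ 1
∣1+n-n∣≡1 zero    = refl
∣1+n-n∣≡1 (suc n) = ∣1+n-n∣≡1 n

step-toward : ∀ {x r} → x ≢ r → ∃[ x′ ] ∣ x - x′ ∣ ≡ 1 × suc ∣ x′ - r ∣ ≡ ∣ x - r ∣ × x′ ≤ x ⊔ r
step-toward {zero}  {zero}  x≢r = contradiction refl x≢r
step-toward {zero}  {suc r} _   = 1 , refl , refl , s≤s z≤n
step-toward {suc x} {zero}  _   = x , ∣1+n-n∣≡1 x , cong suc (∣-∣-identityʳ x) , n≤1+n x
step-toward {suc x} {suc r} x≢r with step-toward (x≢r ∘ cong suc)
... | x′ , e , d , x′≤x⊔r = suc x′ , e , d , s≤s x′≤x⊔r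

step-within : ∀ {B x} → 1 ≤ B → x ≤ B → ∃[ x′ ] ∣ x - x′ ∣ ≡ 1 × x′ ≤ B
step-within {x = zero}  1≤B _   = 1 , refl , 1≤B
step-within {x = suc x} _   x≤B = x , ∣1+n-n∣≡1 x , ≤-trans (n≤1+n x) x≤B

-- d ≼ k: a coordinate gap d can be closed by exactly k unit moves.
infix 4 _≼_

_≼_ : ℕ → ℕ → Set
d ≼ k = d ≤ k × parity d ≡ parity k

≼-pred : ∀ {d k} → suc d ≼ suc k → d ≼ k
≼-pred {d} {k} (s≤s d≤k , p) = d≤k , trans (sym (suc-homo-⁻¹ d)) (trans (cong _⁻¹ p) (suc-homo-⁻¹ k))

0≼1+k⇒1≼k : ∀ {k} → 0 ≼ suc k → 1 ≼ k
0≼1+k⇒1≼k {zero}  (_ , ())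
0≼1+k⇒1≼k {suc k} (_ , p) = s≤s z≤n , trans (cong _⁻¹ p) (sym (parity-suc k))

⊔-≼ : ∀ {a b} → parity a ≡ parity b → a ≼ a ⊔ b × b ≼ a ⊔ b
⊔-≼ {a} {b} p with ⊔-sel a b
... | inj₁ e = (m≤m⊔n a b , cong parity (sym e)) , (m≤n⊔m a b , trans (sym p) (cong parity (sym e)))
... | inj₂ e = (m≤m⊔n a b , trans p (cong parity (sym e))) , (m≤n⊔m a b , cong parity (sym e))

coordinate-step : ∀ {B x r k} → 1 ≤ B → x ≤ B → r ≤ B → ∣ x - r ∣ ≼ suc k →
                  ∃[ x′ ] x′ ≤ B × ∣ x - x′ ∣ ≡ 1 × ∣ x′ - r ∣ ≼ k
coordinate-step {x = x} {r} {k} 1≤B x≤B r≤B gap with x ≟ r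
... | yes refl with step-within 1≤B x≤B
...   | x′ , e , x′≤B =
  x′ , x′≤B , e ,
  subst (_≼ k) (sym (trans (∣-∣-comm x′ x) e)) (0≼1+k⇒1≼k (subst (_≼ suc k) (∣n-n∣≡0 x) gap))
coordinate-step {x = x} {r} {k} 1≤B x≤B r≤B gap | no x≢r with step-toward x≢r
...   | x′ , e , d , x′≤x⊔r =
  x′ , ≤-trans x′≤x⊔r (⊔-lub x≤B r≤B) , e , ≼-pred (subst (_≼ suc k) (sym d) gap)

parity-∣-∣-cong : ∀ {x x′ y y′} → parity x ≡ parity y → parity x′ ≡ parity y′ →
                  parity ∣ x - x′ ∣ ≡ parity ∣ y - y′ ∣
parity-∣-∣-cong {x} {x′} {y} {y′} p p′ = begin
  parity ∣ x - x′ ∣         ≡⟨ parity-∣-∣ x x′ ⟩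
  parity (x + x′)           ≡⟨ +-homo-+ x x′ ⟩
  parity x ℙ.+ parity x′    ≡⟨ cong₂ ℙ._+_ p p′ ⟩
  parity y ℙ.+ parity y′    ≡⟨ +-homo-+ y y′ ⟨
  parity (y + y′)           ≡⟨ parity-∣-∣ y y′ ⟨
  parity ∣ y - y′ ∣         ∎
  where open ≡-Reasoning

module _ {m n : ℕ} (1≤m : 1 ≤ m) (1≤n : 1 ≤ n) where

  private
    1≤2n : 1 ≤ 2 * n
    1≤2n = ≤-trans 1≤n (m≤m+n n (n + 0))

    1≤2m : 1 ≤ 2 * m
    1≤2m = ≤-trans 1≤m (m≤m+n m (m + 0))

  walk-within : ∀ k {x y x′ y′} →
                Checkerboard (2 * n) (2 * m) (x , y) → Checkerboard (2 * n) (2 * m) (x′ , y′) →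
                ∣ x - x′ ∣ ≼ k → ∣ y - y′ ∣ ≼ k → Walk m (suc n) (x , y) (x′ , y′) k
  walk-within zero {x} {y} {x′} {y′} c _ (dx≤0 , _) (dy≤0 , _)
    with ∣m-n∣≡0⇒m≡n {x} {x′} (n≤0⇒n≡0 dx≤0) | ∣m-n∣≡0⇒m≡n {y} {y′} (n≤0⇒n≡0 dy≤0)
  ... | refl | refl = here (checkerboard⇒isVertex c)
  walk-within (suc k) {x} {y} c@(x≤2n , y≤2m , px≡py) c′@(x′≤2n , y′≤2m , _) gx gy
    with coordinate-step 1≤2n x≤2n x′≤2n gx | coordinate-step 1≤2m y≤2m y′≤2m gy
  ... | x₁ , x₁≤2n , ex , gx₁ | y₁ , y₁≤2m , ey , gy₁ =
    step (checkerboard⇒isVertex c) (ex , ey) (walk-within k (x₁≤2n , y₁≤2m , px₁≡py₁) c′ gx₁ gy₁)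
    where
      px₁≡py₁ : parity x₁ ≡ parity y₁
      px₁≡py₁ = trans (∣m-n∣≡1⇒parity-flip x x₁ ex)
                      (trans (cong _⁻¹ px≡py) (sym (∣m-n∣≡1⇒parity-flip y y₁ ey)))

  dist-chebyshev : ∀ {u v} → Checkerboard (2 * n) (2 * m) u → Checkerboard (2 * n) (2 * m) v →
                   Dist m (suc n) u v (chebyshev u v)
  dist-chebyshev {x , y} {x′ , y′} cu@(_ , _ , px≡py) cv@(_ , _ , px′≡py′) =
    walk-within _ cu cv (proj₁ gaps) (proj₂ gaps) , λ k k<d walk → <⇒≱ k<d (chebyshev≤walk-length walk)
    where
      gaps : ∣ x - x′ ∣ ≼ chebyshev (x , y) (x′ , y′) × ∣ y - y′ ∣ ≼ chebyshev (x , y) (x′ , y′)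
      gaps = ⊔-≼ (parity-∣-∣-cong {x} {x′} {y} {y′} px≡py px′≡py′)

∣x-h∣≤h∸y : ∀ {x y h} → y ≤ x → y ≤ h → y + x ≤ 2 * h → ∣ x - h ∣ ≤ h ∸ y
∣x-h∣≤h∸y {x} {y} {h} y≤x y≤h y+x≤2h with ≤-total x h
... | inj₁ x≤h = subst (_≤ h ∸ y) (sym (m≤n⇒∣m-n∣≡n∸m x≤h)) (∸-monoʳ-≤ h y≤x)
... | inj₂ h≤x = subst (_≤ h ∸ y) (sym (m≤n⇒∣n-m∣≡n∸m h≤x)) (m≤n+o⇒m∸n≤o x h x≤h+[h∸y])
  where
    open ≤-Reasoning
    x≤h+[h∸y] : x ≤ h + (h ∸ y)
    x≤h+[h∸y] = begin
      x             ≤⟨ m+n≤o⇒m≤o∸n x (subst (_≤ 2 * h) (+-comm y x) y+x≤2h) ⟩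
      2 * h ∸ y     ≡⟨ cong (λ k → h + k ∸ y) (+-identityʳ h) ⟩
      h + h ∸ y     ≡⟨ +-∸-assoc h y≤h ⟩
      h + (h ∸ y)   ∎

m∸n<o⇒m<n+o : ∀ {m n o} → n ≤ m → m ∸ n < o → m < n + o
m∸n<o⇒m<n+o {m} {n} n≤m m∸n<o = subst (_< n + _) (m+[n∸m]≡n n≤m) (+-monoʳ-< n m∸n<o)

module Decoding (W H : ℕ) where

  code : Point → ℕ × ℕ × ℕ
  code u = chebyshev u (0 , 0) , chebyshev u (H , H) , chebyshev u (W , 0)

  decode : ℕ × ℕ × ℕ → Point
  decode (a , b , c) with a + c ≟ W | c <? a
  ... | yes _ | _     = a , H ∸ b
  ... | no _  | yes _ = a , c
  ... | no _  | no _  = H ∸ b , a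

  decode-a+c≡W : ∀ {a b c} → a + c ≡ W → decode (a , b , c) ≡ (a , H ∸ b)
  decode-a+c≡W {a} {b} {c} a+c≡W with a + c ≟ W | c <? a
  ... | yes _     | _ = refl
  ... | no a+c≢W  | _ = contradiction a+c≡W a+c≢W

  decode-c<a : ∀ {a b c} → a + c ≢ W → c < a → decode (a , b , c) ≡ (a , c)
  decode-c<a {a} {b} {c} a+c≢W c<a with a + c ≟ W | c <? a
  ... | yes a+c≡W | _       = contradiction a+c≡W a+c≢W
  ... | no _      | yes _   = refl
  ... | no _      | no c≮a  = contradiction c<a c≮a

  decode-c≮a : ∀ {a b c} → a + c ≢ W → c ≮ a → decode (a , b , c) ≡ (H ∸ b , a)
  decode-c≮a {a} {b} {c} a+c≢W c≮a with a + c ≟ W | c <? a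
  ... | yes a+c≡W | _       = contradiction a+c≡W a+c≢W
  ... | no _      | yes c<a = contradiction c<a c≮a
  ... | no _      | no _    = refl

  decode-left-wedge : ∀ {x y} → x < y → x ≤ W → y ≤ H →
                      decode (x ⊔ y , ∣ x - H ∣ ⊔ (H ∸ y) , (W ∸ x) ⊔ y) ≡ (x , y)
  decode-left-wedge {x} {y} x<y x≤W y≤H
    rewrite m≤n⇒m⊔n≡n (<⇒≤ x<y) | m≤n⇒∣m-n∣≡n∸m (≤-trans (<⇒≤ x<y) y≤H)
          | m≥n⇒m⊔n≡m (∸-monoʳ-≤ H (<⇒≤ x<y)) =
    trans (decode-c≮a (>⇒≢ W<y+c) (≤⇒≯ (m≤n⊔m (W ∸ x) y))) (cong (_, y) (m∸[m∸n]≡n x≤H))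
    where
      open ≤-Reasoning
      x≤H : x ≤ H
      x≤H = ≤-trans (<⇒≤ x<y) y≤H
      W<y+c : W < y + ((W ∸ x) ⊔ y)
      W<y+c = begin-strict
        W                  ≡⟨ m+[n∸m]≡n x≤W ⟨
        x + (W ∸ x)        <⟨ +-monoˡ-< (W ∸ x) x<y ⟩
        y + (W ∸ x)        ≤⟨ +-monoʳ-≤ y (m≤m⊔n (W ∸ x) y) ⟩
        y + ((W ∸ x) ⊔ y)  ∎

  decode-bottom-wedge : ∀ {x y} → y ≤ x → y ≤ W ∸ x → x ≤ W → y ≤ H → W ≤ 2 * H →
                        decode (x ⊔ y , ∣ x - H ∣ ⊔ (H ∸ y) , (W ∸ x) ⊔ y) ≡ (x , y)
  decode-bottom-wedge {x} {y} y≤x y≤W∸x x≤W y≤H W≤2H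
    rewrite m≥n⇒m⊔n≡m y≤x | m≥n⇒m⊔n≡m y≤W∸x
          | m≤n⇒m⊔n≡n (∣x-h∣≤h∸y y≤x y≤H (≤-trans (m≤o∸n⇒m+n≤o y x≤W y≤W∸x) W≤2H)) =
    trans (decode-a+c≡W (m+[n∸m]≡n x≤W)) (cong (x ,_) (m∸[m∸n]≡n y≤H))

  decode-right-wedge : ∀ {x y} → y ≤ x → W ∸ x < y → x ≤ W → y ≤ H →
                       decode (x ⊔ y , ∣ x - H ∣ ⊔ (H ∸ y) , (W ∸ x) ⊔ y) ≡ (x , y)
  decode-right-wedge {x} {y} y≤x W∸x<y x≤W y≤H
    rewrite m≥n⇒m⊔n≡m y≤x | m≤n⇒m⊔n≡n (<⇒≤ W∸x<y) with m≤n⇒m<n∨m≡n y≤x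
  ... | inj₁ y<x  = decode-c<a (>⇒≢ (m∸n<o⇒m<n+o x≤W W∸x<y)) y<x
  ... | inj₂ refl rewrite m≤n⇒∣m-n∣≡n∸m y≤H | ⊔-idem (H ∸ y) =
    trans (decode-c≮a (>⇒≢ (m∸n<o⇒m<n+o x≤W W∸x<y)) (<-irrefl refl)) (cong (_, y) (m∸[m∸n]≡n y≤H))

  decode-code : ∀ {x y} → x ≤ W → y ≤ H → W ≤ 2 * H → decode (code (x , y)) ≡ (x , y)
  decode-code {x} {y} x≤W y≤H W≤2H
    rewrite ∣-∣-identityʳ x | ∣-∣-identityʳ y | m≤n⇒∣m-n∣≡n∸m y≤H | m≤n⇒∣m-n∣≡n∸m x≤W
    with y ≤? x | y ≤? W ∸ x
  ... | no y≰x  | _           = decode-left-wedge (≰⇒> y≰x) x≤W y≤H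
  ... | yes y≤x | yes y≤W∸x   = decode-bottom-wedge y≤x y≤W∸x x≤W y≤H W≤2H
  ... | yes y≤x | no y≰W∸x    = decode-right-wedge y≤x (≰⇒> y≰W∸x) x≤W y≤H

  code-injective : ∀ {x y x′ y′} → x ≤ W → y ≤ H → x′ ≤ W → y′ ≤ H → W ≤ 2 * H →
                   code (x , y) ≡ code (x′ , y′) → (x , y) ≡ (x′ , y′)
  code-injective {x} {y} {x′} {y′} x≤W y≤H x′≤W y′≤H W≤2H same-code = begin
    (x , y)                ≡⟨ decode-code x≤W y≤H W≤2H ⟨
    decode (code (x , y))  ≡⟨ cong decode same-code ⟩
    decode (code (x′ , y′)) ≡⟨ decode-code x′≤W y′≤H W≤2H ⟩
    (x′ , y′)              ∎
    where open ≡-Reasoning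

landmarks : ℕ → ℕ → List Point
landmarks m n = (0 , 0) ∷ (2 * m , 2 * m) ∷ (2 * n , 0) ∷ []

landmarks-resolve : ∀ {m n} → 1 ≤ m → m ≤ n → n ≤ 2 * m → IsResolving m (suc n) (landmarks m n)
landmarks-resolve {m} {n} 1≤m m≤n n≤2m =
  checkerboard⇒isVertex origin ∷ checkerboard⇒isVertex diagonal ∷ checkerboard⇒isVertex corner ∷ [] ,
  separate
  where
    open Decoding (2 * n) (2 * m)

    origin : Checkerboard (2 * n) (2 * m) (0 , 0)
    origin = z≤n , z≤n , refl
    diagonal : Checkerboard (2 * n) (2 * m) (2 * m , 2 * m)
    diagonal = *-monoʳ-≤ 2 m≤n , ≤-refl , refl
    corner : Checkerboard (2 * n) (2 * m) (2 * n , 0)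
    corner = ≤-refl , z≤n , parity-double n

    dist : ∀ {u v} → Checkerboard (2 * n) (2 * m) u → Checkerboard (2 * n) (2 * m) v →
           Dist m (suc n) u v (chebyshev u v)
    dist = dist-chebyshev 1≤m (≤-trans 1≤m m≤n)

    separate : ∀ s t → IsVertex m (suc n) s → IsVertex m (suc n) t → s ≢ t →
               ∃[ r ] ∃[ a ] ∃[ b ] (r ∈ landmarks m n × Dist m (suc n) s r a × Dist m (suc n) t r b × a ≢ b)
    separate s t s∈V t∈V s≢t
      with isVertex⇒checkerboard s∈V | isVertex⇒checkerboard t∈V
         | chebyshev s (0 , 0) ≟ chebyshev t (0 , 0)
         | chebyshev s (2 * m , 2 * m) ≟ chebyshev t (2 * m , 2 * m)
         | chebyshev s (2 * n , 0) ≟ chebyshev t (2 * n , 0)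
    ... | cs | ct | no ≢₀ | _     | _     = _ , _ , _ , here refl , dist cs origin , dist ct origin , ≢₀
    ... | cs | ct | yes _ | no ≢₁ | _     = _ , _ , _ , there (here refl) , dist cs diagonal , dist ct diagonal , ≢₁
    ... | cs | ct | yes _ | yes _ | no ≢₂ = _ , _ , _ , there (there (here refl)) , dist cs corner , dist ct corner , ≢₂
    ... | cs@(x≤W , y≤H , _) | ct@(x′≤W , y′≤H , _) | yes ≡₀ | yes ≡₁ | yes ≡₂ =
      contradiction (code-injective x≤W y≤H x′≤W y′≤H (*-monoʳ-≤ 2 n≤2m) (cong₂ _,_ ≡₀ (cong₂ _,_ ≡₁ ≡₂))) s≢t

lemma7 : (m n : ℕ) → 1 ≤ m → m < n → n ≤ 2 * m + 1 → DimLE m n 3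
lemma7 m (suc n) 1≤m (s≤s m≤n) 1+n≤2m+1 = landmarks m n , landmarks-resolve 1≤m m≤n n≤2m , ≤-refl
  where
    n≤2m : n ≤ 2 * m
    n≤2m = s≤s⁻¹ (subst (suc n ≤_) (+-comm (2 * m) 1) 1+n≤2m+1)
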